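{- Let $\Gamma$ be a regular hypertope over $I=\{0,\dots,n-1\}$ whose Buekenhout diagram has $0$ as a leaf adjacent only to $1$, and suppose that $\Gamma$ does not satisfy condition $(B_1)$ for the pair $\{0,1\}$. Let $G=\mathrm{Aut}(\Gamma)=\langle\rho_0,\dots,\rho_{n-1}\rangle$ with standard generators. Then the halving group $H(G)=\langle\rho_0\rho_1\rho_0,\rho_1,\dots,\rho_{n-1}\rangle$, with this generating set, is not a C-group.
   Context: A regular hypertope is a thin, residually connected, flag-transitive incidence geometry; with respect to a base chamber $C$, $\rho_i$ is the unique automorphism mapping $C$ to its $i$-adjacent chamber. The Buekenhout diagram has vertex set $I$, with an edge $\{i,j\}$ unless every residue of type $\{i,j\}$ is a generalized digon (every element of type $i$ incident to every element of type $j$ in it). $(B_1)$ for $\{0,1\}$: the $\{0,1\}$-truncation of $\Gamma$ is the geometry of a simple graph (each $1$-element incident to exactly two $0$-elements, two $0$-elements incident to at most one common $1$-element). A C-group is a group $G$ with a generating set of involutions $\{r_0,\dots,r_{n-1}\}$ satisfying the intersection property: $\langle r_i\mid i\in J\rangle\cap\langle r_i\mid i\in K\rangle=\langle r_i\mid i\in J\cap K\rangle$ for all $J,K\subseteq I$. -}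

module Defs where

open import Data.Nat using (ℕ; zero; suc; _+_; _≤_)
open import Data.Fin using (Fin; zero; suc)
open import Data.Fin.Subset using (Subset; _∈_; _∉_; ∁; ⁅_⁆; _∩_; _∪_; ∣_∣)
open import Data.Product using (Σ; ∃; ∃₂; _×_; _,_; proj₁; proj₂)
open import Data.Sum using (_⊎_)
open import Data.Bool using (Bool; true; false)
open import Data.List using (List; []; _∷_)
open import Relation.Nullary using (¬_)
open import Relation.Binary.PropositionalEquality
  using (_≡_; _≢_; refl; sym; trans; cong; subst)
open import Relation.Binary.Construct.Closure.ReflexiveTransitive using (Star)
open import Function using (_∘_)

record Geometry (n : ℕ) : Set₁ where
  field
    X      : Set
    t      : X → Fin n
    _*_    : X → X → Set
    *-refl : ∀ x → x * x
    *-sym  : ∀ {x y} → x * y → y * x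
    *-type : ∀ {x y} → x * y → t x ≡ t y → x ≡ y

module _ {n : ℕ} (Γ : Geometry n) where
  open Geometry Γ

  record Flag (J : Subset n) : Set where
    field
      el      : (i : Fin n) → i ∈ J → X
      el-type : ∀ i (p : i ∈ J) → t (el i p) ≡ i
      el-inc  : ∀ i j (p : i ∈ J) (q : j ∈ J) → el i p * el j q
  open Flag public

  record Chamber : Set where
    field
      ch      : Fin n → X
      ch-type : ∀ i → t (ch i) ≡ i
      ch-inc  : ∀ i j → ch i * ch j
  open Chamber public

  _≈ᶜ_ : Chamber → Chamber → Set
  C ≈ᶜ D = ∀ i → ch C i ≡ ch D i

  _⊑_ : ∀ {J} → Flag J → Chamber → Set
  F ⊑ C = ∀ i p → el F i p ≡ ch C i

  IsIncidenceGeometry : Set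
  IsIncidenceGeometry = ∀ J (F : Flag J) → Σ Chamber (λ C → F ⊑ C)

  InRes : ∀ {J} → Flag J → X → Set
  InRes {J} F y = (t y ∉ J) × (∀ i p → y * el F i p)

  ResEdge : ∀ {J} → Flag J → X → X → Set
  ResEdge F a b = InRes F a × InRes F b × (a * b)

  -- every residue of rank ≥ 2 (including Γ itself) has connected incidence graph
  ResiduallyConnected : Set
  ResiduallyConnected =
    ∀ J (F : Flag J) → 2 + ∣ J ∣ ≤ n →
    ∀ y z → InRes F y → InRes F z → Star (ResEdge F) y z

  Thin : Set
  Thin = ∀ i (F : Flag (∁ ⁅ i ⁆)) →
    Σ Chamber λ C → Σ Chamber λ D →
      F ⊑ C × F ⊑ D × ¬ (C ≈ᶜ D) ×
      (∀ E → F ⊑ E → (E ≈ᶜ C) ⊎ (E ≈ᶜ D))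

  record Aut : Set where
    field
      f      : X → X
      g      : X → X
      fg     : ∀ x → f (g x) ≡ x
      gf     : ∀ x → g (f x) ≡ x
      f-type : ∀ x → t (f x) ≡ t x
      f-inc  : ∀ {x y} → x * y → f x * f y
      f-inc⁻ : ∀ {x y} → f x * f y → x * y
  open Aut public

  _≈ᴬ_ : Aut → Aut → Set
  φ ≈ᴬ ψ = ∀ x → f φ x ≡ f ψ x

  idA : Aut
  idA = record { f = λ x → x ; g = λ x → x ; fg = λ _ → refl ; gf = λ _ → refl
               ; f-type = λ _ → refl ; f-inc = λ p → p ; f-inc⁻ = λ p → p }

  _∘ᴬ_ : Aut → Aut → Aut
  φ ∘ᴬ ψ = record
    { f = f φ ∘ f ψ
    ; g = g ψ ∘ g φ
    ; fg = λ x → trans (cong (f φ) (fg ψ (g φ x))) (fg φ x)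
    ; gf = λ x → trans (cong (g ψ) (gf φ (f ψ x))) (gf ψ x)
    ; f-type = λ x → trans (f-type φ (f ψ x)) (f-type ψ x)
    ; f-inc = λ p → f-inc φ (f-inc ψ p)
    ; f-inc⁻ = λ p → f-inc⁻ ψ (f-inc⁻ φ p)
    }

  invA : Aut → Aut
  invA φ = record
    { f = g φ
    ; g = f φ
    ; fg = gf φ
    ; gf = fg φ
    ; f-type = λ x → trans (sym (f-type φ (g φ x))) (cong t (fg φ x))
    ; f-inc = λ {x} {y} p → f-inc⁻ φ (subst (λ z → z * f φ (g φ y)) (sym (fg φ x))
                                        (subst (λ z → x * z) (sym (fg φ y)) p))
    ; f-inc⁻ = λ {x} {y} p → subst (λ z → z * y) (fg φ x)
                                (subst (λ z → f φ (g φ x) * z) (fg φ y) (f-inc φ p))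
    }

  FlagTransitive : Set
  FlagTransitive = ∀ J (F F' : Flag J) →
    Σ Aut λ φ → ∀ i p → f φ (el F i p) ≡ el F' i p

  RegularHypertope : Set
  RegularHypertope =
    IsIncidenceGeometry × Thin × ResiduallyConnected × FlagTransitive

  -- Buekenhout diagram: no edge {i,j} iff every residue of type {i,j}
  -- is a generalized digon
  NoEdge : Fin n → Fin n → Set
  NoEdge i j = ∀ (F : Flag (∁ (⁅ i ⁆ ∪ ⁅ j ⁆))) x y →
    InRes F x → InRes F y → t x ≡ i → t y ≡ j → x * y

  Edge : Fin n → Fin n → Set
  Edge i j = ¬ NoEdge i j

  -- (B1) for the pair {i,j} (used with i = 0, j = 1): the {i,j}-truncation
  -- is the geometry of a simple graph
  B1 : Fin n → Fin n → Set
  B1 i j =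
    (∀ e → t e ≡ j →
       Σ X λ a → Σ X λ b → t a ≡ i × t b ≡ i × a ≢ b × a * e × b * e ×
         (∀ c → t c ≡ i → c * e → c ≡ a ⊎ c ≡ b)) ×
    (∀ a b e e' → t a ≡ i → t b ≡ i → a ≢ b → t e ≡ j → t e' ≡ j →
       a * e → b * e → a * e' → b * e' → e ≡ e')

  -- ρ : Fin n → Aut are the standard generators w.r.t. the base chamber C:
  -- ρ i maps C to its i-adjacent chamber (fixes C j for j ≠ i, moves C i)
  StandardGenerators : Chamber → (Fin n → Aut) → Set
  StandardGenerators C ρ = ∀ i →
    (∀ j → j ≢ i → f (ρ i) (ch C j) ≡ ch C j) × (f (ρ i) (ch C i) ≢ ch C i)

  -- words in the generators r i (i ∈ J) and their inverses
  Word : Subset n → Set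
  Word J = List (Σ (Fin n) (λ i → i ∈ J) × Bool)

  eval : (Fin n → Aut) → ∀ {J} → Word J → Aut
  eval r [] = idA
  eval r (((i , _) , true) ∷ w) = r i ∘ᴬ eval r w
  eval r (((i , _) , false) ∷ w) = invA (r i) ∘ᴬ eval r w

  InGen : (Fin n → Aut) → Subset n → Aut → Set
  InGen r J φ = Σ (Word J) λ w → eval r w ≈ᴬ φ

  IntersectionProperty : (Fin n → Aut) → Set
  IntersectionProperty r = ∀ J K φ →
    ((InGen r J φ × InGen r K φ) → InGen r (J ∩ K) φ) ×
    (InGen r (J ∩ K) φ → InGen r J φ × InGen r K φ)

  IsCGroup : (Fin n → Aut) → Set
  IsCGroup r = (∀ i → (r i ∘ᴬ r i) ≈ᴬ idA) × IntersectionProperty r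

halving : ∀ {m} (Γ : Geometry (suc (suc m))) →
  (Fin (suc (suc m)) → Aut Γ) → Fin (suc (suc m)) → Aut Γ
halving Γ ρ zero = _∘ᴬ_ Γ (ρ zero) (_∘ᴬ_ Γ (ρ (suc zero)) (ρ zero))
halving Γ ρ (suc i) = ρ (suc i)

{-# OPTIONS --safe #-}
-- Let C₀, C₁ be the 0- and 1-elements of the base chamber C and D₀ = ρ₀ C₀. In a thin, residually
-- connected geometry any two chambers through a flag are joined by a gallery in its residue; by
-- thinness an automorphism is then determined by the image of one chamber, and the stabiliser of
-- the subflag of C of type J is ⟨ρⱼ ∣ j ∉ J⟩. As 0 is joined only to 1, ρ₀ commutes with ρⱼ for
-- j ≥ 2, so the stabiliser ⟨ρⱼ ∣ j ≠ 1⟩ of C₁ preserves {C₀, D₀}: with flag-transitivity, every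
-- 1-element is incident to exactly two 0-elements. For the halving generators hⱼ the stabilisers
-- of C₀ and D₀ are ⟨hⱼ ∣ j ≠ 0⟩ and ρ₀⟨ρⱼ ∣ j ≠ 0⟩ρ₀ = ⟨hⱼ ∣ j ≠ 1⟩. Under the intersection
-- property an automorphism fixing C₀ and D₀ thus lies in ⟨ρⱼ ∣ j ≥ 2⟩ and fixes C₁, so two
-- 0-elements share at most one 1-element. Hence (B₁) would hold.
module Submission where

open import Defs
open import Data.Nat using (ℕ; suc; _+_; _≤_; _<_; _≤?_; s≤s)
open import Data.Nat.Properties using (≤-trans; +-suc; +-monoʳ-≤; m≤m+n; m≤n⇒m≤1+n; <⇒≱)
open import Data.Fin using (Fin; zero; suc)
open import Data.Fin.Patterns using (0F; 1F)
open import Data.Fin.Properties using (_≟_)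
open import Data.Fin.Permutation.Components using (transpose)
open import Data.Fin.Subset using (Subset; _∈_; _∉_; _⊆_; ∁; ⁅_⁆; _∩_; _∪_; ∣_∣; ⊥; ⊤)
open import Data.Fin.Subset.Properties
  using (x∈⁅x⁆; x∈⁅y⁆⇒x≡y; x≢y⇒x∉⁅y⁆; x∉⁅y⁆⇒x≢y; x∈∁p⇒x∉p; x∉p⇒x∈∁p; x∈p⇒x∉∁p; x∉∁p⇒x∈p;
         x∈p∪q⁻; x∈p∪q⁺; p⊆p∪q; x∈p∩q⁻; ∉⊥; ∈⊤; p⊂q⇒∣p∣<∣q∣; ∣p∣≤n; nonempty?; _∈?_)
open import Data.Product using (Σ; _×_; _,_; proj₁; proj₂)
open import Data.Sum using (_⊎_; inj₁; inj₂; [_,_])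
import Data.Sum as Sum
open import Data.Bool using (true; false)
open import Data.List using ([]; _∷_; _++_)
open import Data.Empty using (⊥-elim)
open import Function using (id; _∘_)
open import Relation.Nullary using (¬_; Dec; yes; no)
open import Relation.Binary.PropositionalEquality using (_≡_; _≢_; refl; sym; trans; cong; subst)
open import Relation.Binary.Construct.Closure.ReflexiveTransitive using (Star; ε; _◅_; _◅◅_)
  renaming (map to Star-map)

∣p∣<∣p∪⁅x⁆∣ : ∀ {n} {p : Subset n} {x} → x ∉ p → ∣ p ∣ < ∣ p ∪ ⁅ x ⁆ ∣
∣p∣<∣p∪⁅x⁆∣ {x = x} x∉p = p⊂q⇒∣p∣<∣q∣ (p⊆p∪q _ , x , x∈p∪q⁺ (inj₂ (x∈⁅x⁆ x)) , x∉p)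

x∉p∧y∉p∧x≢y⇒2+∣p∣≤n : ∀ {n} {p : Subset n} {x y} → x ∉ p → y ∉ p → x ≢ y → 2 + ∣ p ∣ ≤ n
x∉p∧y∉p∧x≢y⇒2+∣p∣≤n {p = p} {x} {y} x∉p y∉p x≢y =
  ≤-trans (s≤s (∣p∣<∣p∪⁅x⁆∣ x∉p)) (≤-trans (∣p∣<∣p∪⁅x⁆∣ y∉p∪⁅x⁆) (∣p∣≤n ((p ∪ ⁅ x ⁆) ∪ ⁅ y ⁆)))
  where
  y∉p∪⁅x⁆ = [ y∉p , (λ y∈⁅x⁆ → x≢y (sym (x∈⁅y⁆⇒x≡y x y∈⁅x⁆))) ] ∘ x∈p∪q⁻ p ⁅ x ⁆

n≤1+d+∣p∣⇒n≤d+∣p∪⁅x⁆∣ : ∀ {n d} {p : Subset n} → n ≤ suc d + ∣ p ∣ → ∀ {x} → x ∉ p → n ≤ d + ∣ p ∪ ⁅ x ⁆ ∣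
n≤1+d+∣p∣⇒n≤d+∣p∪⁅x⁆∣ {d = d} {p} n≤1+d+p {x} x∉p =
  ≤-trans n≤1+d+p (subst (_≤ d + ∣ p ∪ ⁅ x ⁆ ∣) (+-suc d ∣ p ∣) (+-monoʳ-≤ d (∣p∣<∣p∪⁅x⁆∣ x∉p)))

x≢y⇒x∈∁⁅y⁆ : ∀ {n} {x y : Fin n} → x ≢ y → x ∈ ∁ ⁅ y ⁆
x≢y⇒x∈∁⁅y⁆ = x∉p⇒x∈∁p ∘ x≢y⇒x∉⁅y⁆

x∈∁⁅y⁆⇒x≢y : ∀ {n} {x y : Fin n} → x ∈ ∁ ⁅ y ⁆ → x ≢ y
x∈∁⁅y⁆⇒x≢y = x∉⁅y⁆⇒x≢y ∘ x∈∁p⇒x∉p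

module Incidence {n : ℕ} (Γ : Geometry n) where
  open Geometry Γ

  infix 4 _~⟨_⟩_ _∋_
  infixr 9 _·_
  infix 8 _↾_

  record _~⟨_⟩_ (A : Chamber Γ) (k : Fin n) (B : Chamber Γ) : Set where
    constructor agree-off
    field at : ∀ l → l ≢ k → ch A l ≡ ch B l
  open _~⟨_⟩_

  _∋_ : Chamber Γ → X → Set
  A ∋ y = ch A (t y) ≡ y

  ch-∋ : ∀ A i → A ∋ ch A i
  ch-∋ A i = cong (ch A) (ch-type A i)

  ~⟨⟩⇒≈ᶜ : ∀ {A B k} → A ~⟨ k ⟩ B → ch A k ≡ ch B k → _≈ᶜ_ Γ A B
  ~⟨⟩⇒≈ᶜ {k = k} A~B eq l with l ≟ k
  ... | yes refl = eq
  ... | no l≢k = at A~B l l≢k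

  _↾_ : Chamber Γ → (J : Subset n) → Flag Γ J
  A ↾ J = record { el = λ i _ → ch A i ; el-type = λ i _ → ch-type A i ; el-inc = λ i j _ _ → ch-inc A i j }

  _·_ : Aut Γ → Chamber Γ → Chamber Γ
  φ · A = record
    { ch = f φ ∘ ch A
    ; ch-type = λ i → trans (f-type φ (ch A i)) (ch-type A i)
    ; ch-inc = λ i j → f-inc φ (ch-inc A i j)
    }

  f≡⇒g≡ : ∀ (φ : Aut Γ) {x y} → f φ x ≡ y → g φ y ≡ x
  f≡⇒g≡ φ {x} refl = gf φ x

  g≡⇒f≡ : ∀ (φ : Aut Γ) {x y} → g φ x ≡ y → f φ y ≡ x
  g≡⇒f≡ φ {x} refl = fg φ x

  injective : ∀ (φ : Aut Γ) {x y} → f φ x ≡ f φ y → x ≡ y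
  injective φ {x} e = trans (sym (gf φ x)) (f≡⇒g≡ φ (sym e))

  *-pull : ∀ (φ : Aut Γ) {x y z} → f φ y ≡ z → x * z → g φ x * y
  *-pull φ {x} fy≡z x*z = subst (g φ x *_) (f≡⇒g≡ φ fy≡z) (f-inc (invA Γ φ) x*z)

  g-cong : ∀ {φ ψ} → _≈ᴬ_ Γ φ ψ → ∀ x → g φ x ≡ g ψ x
  g-cong {φ} {ψ} φ≈ψ x = injective ψ (trans (sym (φ≈ψ (g φ x))) (trans (fg φ x) (sym (fg ψ x))))

  conjugate : Aut Γ → (Fin n → Aut Γ) → Fin n → Aut Γ
  conjugate φ ρ j = _∘ᴬ_ Γ φ (_∘ᴬ_ Γ (ρ j) (invA Γ φ))

  StandardGenerators-conjugate : ∀ {C ρ} φ → StandardGenerators Γ C ρ →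
                                 StandardGenerators Γ (φ · C) (conjugate φ ρ)
  StandardGenerators-conjugate {C} {ρ} φ SG i = fixes , moves
    where
    back : ∀ j → f φ (f (ρ i) (g φ (f φ (ch C j)))) ≡ f φ (f (ρ i) (ch C j))
    back j = cong (f φ ∘ f (ρ i)) (gf φ (ch C j))
    fixes : ∀ j → j ≢ i → f φ (f (ρ i) (g φ (f φ (ch C j)))) ≡ f φ (ch C j)
    fixes j j≢i = trans (back j) (cong (f φ) (proj₁ (SG i) j j≢i))
    moves : f φ (f (ρ i) (g φ (f φ (ch C i)))) ≢ f φ (ch C i)
    moves eq = proj₂ (SG i) (injective φ (trans (sym (back i)) eq))

  module _ (r : Fin n → Aut Γ) where
    eval-++ : ∀ {J} (w v : Word Γ J) x → f (eval Γ r (w ++ v)) x ≡ f (eval Γ r w) (f (eval Γ r v) x)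
    eval-++ [] v x = refl
    eval-++ (((i , _) , true) ∷ w) v x = cong (f (r i)) (eval-++ w v x)
    eval-++ (((i , _) , false) ∷ w) v x = cong (g (r i)) (eval-++ w v x)

    eval-preserves : ∀ {J} (P : X → Set) →
                     (∀ i → i ∈ J → ∀ {x} → P x → P (f (r i) x) × P (g (r i) x)) →
                     ∀ (w : Word Γ J) {x} → P x → P (f (eval Γ r w) x)
    eval-preserves P r-pres [] Px = Px
    eval-preserves P r-pres (((i , i∈J) , true) ∷ w) Px = proj₁ (r-pres i i∈J (eval-preserves P r-pres w Px))
    eval-preserves P r-pres (((i , i∈J) , false) ∷ w) Px = proj₂ (r-pres i i∈J (eval-preserves P r-pres w Px))

    eval-fixes : ∀ {J} x → (∀ i → i ∈ J → f (r i) x ≡ x) → ∀ (w : Word Γ J) → f (eval Γ r w) x ≡ x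
    eval-fixes x r-fix w =
      eval-preserves (_≡ x) (λ { i i∈J refl → r-fix i i∈J , f≡⇒g≡ (r i) (r-fix i i∈J) }) w refl

  relabel : ∀ {J K} (σ : Fin n → Fin n) → (∀ {i} → i ∈ J → σ i ∈ K) → Word Γ J → Word Γ K
  relabel σ σ∈ [] = []
  relabel σ σ∈ (((i , i∈J) , b) ∷ w) = ((σ i , σ∈ i∈J) , b) ∷ relabel σ σ∈ w

  module _ (r r' : Fin n → Aut Γ) {J K} (σ : Fin n → Fin n) (σ∈ : ∀ {i} → i ∈ J → σ i ∈ K)
           (r≈r'∘σ : ∀ i → i ∈ J → _≈ᴬ_ Γ (r i) (r' (σ i))) where
    eval-relabel : ∀ w → _≈ᴬ_ Γ (eval Γ r w) (eval Γ r' (relabel σ σ∈ w))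
    eval-relabel [] x = refl
    eval-relabel (((i , i∈J) , true) ∷ w) x = trans (cong (f (r i)) (eval-relabel w x)) (r≈r'∘σ i i∈J _)
    eval-relabel (((i , i∈J) , false) ∷ w) x =
      trans (cong (g (r i)) (eval-relabel w x)) (g-cong {r i} {r' (σ i)} (r≈r'∘σ i i∈J) _)

    InGen-relabel : ∀ φ → InGen Γ r J φ → InGen Γ r' K φ
    InGen-relabel φ (w , w≈φ) = relabel σ σ∈ w , λ x → trans (sym (eval-relabel w x)) (w≈φ x)

  el-irrelevant : ∀ {J} (F : Flag Γ J) i (p q : i ∈ J) → el F i p ≡ el F i q
  el-irrelevant F i p q = *-type (el-inc F i i p q) (trans (el-type F i p) (sym (el-type F i q)))

  ch-InRes : ∀ {J} (F : Flag Γ J) A {k} → _⊑_ Γ F A → k ∉ J → InRes Γ F (ch A k)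
  ch-InRes F A {k} F⊑A k∉J =
    (λ p → k∉J (subst (_∈ _) (ch-type A k) p)) ,
    (λ i p → subst (ch A k *_) (sym (F⊑A i p)) (ch-inc A k i))

  point : (y : X) → Flag Γ ⁅ t y ⁆
  point y = record
    { el = λ _ _ → y
    ; el-type = λ i p → sym (x∈⁅y⁆⇒x≡y (t y) p)
    ; el-inc = λ _ _ _ _ → *-refl y
    }

  point-⊑⇒∋ : ∀ y A → _⊑_ Γ (point y) A → A ∋ y
  point-⊑⇒∋ y A point⊑A = sym (point⊑A (t y) (x∈⁅x⁆ (t y)))

  module _ {J : Subset n} (F : Flag Γ J) (y : X) (y∈Res : InRes Γ F y) where
    private
      split : ∀ {i} → i ∈ J ∪ ⁅ t y ⁆ → i ∈ J ⊎ i ∈ ⁅ t y ⁆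
      split = x∈p∪q⁻ J ⁅ t y ⁆

      el⁺ : ∀ i → i ∈ J ⊎ i ∈ ⁅ t y ⁆ → X
      el⁺ i (inj₁ p) = el F i p
      el⁺ i (inj₂ _) = y

      el⁺-type : ∀ i s → t (el⁺ i s) ≡ i
      el⁺-type i (inj₁ p) = el-type F i p
      el⁺-type i (inj₂ q) = sym (x∈⁅y⁆⇒x≡y (t y) q)

      el⁺-inc : ∀ i j s s' → el⁺ i s * el⁺ j s'
      el⁺-inc i j (inj₁ p) (inj₁ p') = el-inc F i j p p'
      el⁺-inc i j (inj₁ p) (inj₂ _) = *-sym (proj₂ y∈Res i p)
      el⁺-inc i j (inj₂ _) (inj₁ p') = proj₂ y∈Res j p'
      el⁺-inc i j (inj₂ _) (inj₂ _) = *-refl y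

    extend : Flag Γ (J ∪ ⁅ t y ⁆)
    extend = record
      { el = λ i p → el⁺ i (split p)
      ; el-type = λ i p → el⁺-type i (split p)
      ; el-inc = λ i j p q → el⁺-inc i j (split p) (split q)
      }

    ⊑-extend : ∀ A → _⊑_ Γ F A → A ∋ y → _⊑_ Γ extend A
    ⊑-extend A F⊑A A∋y i p with split p
    ... | inj₁ q = F⊑A i q
    ... | inj₂ q = trans (sym A∋y) (cong (ch A) (sym (x∈⁅y⁆⇒x≡y (t y) q)))

    extend-⊑⇒∋ : ∀ A → _⊑_ Γ extend A → A ∋ y
    extend-⊑⇒∋ A ext⊑A = trans (sym (ext⊑A (t y) p)) (top (split p))
      where
      p = x∈p∪q⁺ {p = J} (inj₂ (x∈⁅x⁆ (t y)))
      top : ∀ s → el⁺ (t y) s ≡ y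
      top (inj₁ q) = ⊥-elim (proj₁ y∈Res q)
      top (inj₂ _) = refl

    extend-⊑⇒⊑ : ∀ A → _⊑_ Γ extend A → _⊑_ Γ F A
    extend-⊑⇒⊑ A ext⊑A i q = trans (old (split p)) (ext⊑A i p)
      where
      p = x∈p∪q⁺ {p = J} (inj₁ q)
      old : ∀ s → el F i q ≡ el⁺ i s
      old (inj₁ q') = el-irrelevant F i q q'
      old (inj₂ r) = *-type (*-sym (proj₂ y∈Res i q)) (trans (el-type F i q) (x∈⁅y⁆⇒x≡y (t y) r))

    InRes-extend : ∀ {z} → InRes Γ F z → z * y → t z ≢ t y → InRes Γ extend z
    InRes-extend {z} z∈Res z*y tz≢ty =
      [ proj₁ z∈Res , tz≢ty ∘ x∈⁅y⁆⇒x≡y (t y) ] ∘ split , λ i p → inc i (split p)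
      where
      inc : ∀ i s → z * el⁺ i s
      inc i (inj₁ q) = proj₂ z∈Res i q
      inc i (inj₂ _) = z*y

  chamber-extending : IsIncidenceGeometry Γ → ∀ {J} (F : Flag Γ J) {y} → InRes Γ F y →
                      Σ (Chamber Γ) λ A → _⊑_ Γ F A × A ∋ y
  chamber-extending ig F {y} y∈Res with ig _ (extend F y y∈Res)
  ... | A , ext⊑A = A , extend-⊑⇒⊑ F y y∈Res A ext⊑A , extend-⊑⇒∋ F y y∈Res A ext⊑A

  chamber-through : IsIncidenceGeometry Γ → ∀ y → Σ (Chamber Γ) (_∋ y)
  chamber-through ig y with ig _ (point y)
  ... | A , point⊑A = A , point-⊑⇒∋ y A point⊑A

  chamber-through₂ : IsIncidenceGeometry Γ → ∀ {y z} → y * z → t y ≢ t z → Σ (Chamber Γ) λ A → A ∋ y × A ∋ z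
  chamber-through₂ ig {y} {z} y*z ty≢tz with chamber-extending ig (point y) {z} z∈Res
    where
    z∈Res : InRes Γ (point y) z
    z∈Res = (λ p → ty≢tz (sym (x∈⁅y⁆⇒x≡y (t y) p))) , (λ _ _ → *-sym y*z)
  ... | A , point⊑A , A∋z = A , point-⊑⇒∋ y A point⊑A , A∋z

  -- Chambers are only equal up to _≈ᶜ_, hence the steps `same`.
  data Step (J : Subset n) (A B : Chamber Γ) : Set where
    same     : _≈ᶜ_ Γ A B → Step J A B
    adjacent : ∀ k → k ∉ J → A ~⟨ k ⟩ B → Step J A B

  Gallery : Subset n → Chamber Γ → Chamber Γ → Set
  Gallery J = Star (Step J)

  Gallery-antimono : ∀ {J K} → K ⊆ J → ∀ {A B} → Gallery J A B → Gallery K A B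
  Gallery-antimono K⊆J = Star-map λ
    { (same A≈B) → same A≈B
    ; (adjacent k k∉J A~B) → adjacent k (k∉J ∘ K⊆J) A~B
    }

  module Panels (thin : Thin Γ) where
    private
      panel : ∀ k A → Σ (Chamber Γ) λ P → Σ (Chamber Γ) λ Q → ch P k ≢ ch Q k ×
              (∀ E → A ~⟨ k ⟩ E → ch E k ≡ ch P k ⊎ ch E k ≡ ch Q k)
      panel k A with thin k (A ↾ ∁ ⁅ k ⁆)
      ... | P , Q , A⊑P , A⊑Q , P≉Q , two =
        P , Q , P≢Q ,
        λ E A~E → Sum.map (λ E≈P → E≈P k) (λ E≈Q → E≈Q k) (two E (λ l p → at A~E l (x∈∁⁅y⁆⇒x≢y p)))
        where
        P≢Q : ch P k ≢ ch Q k
        P≢Q eq = P≉Q (~⟨⟩⇒≈ᶜ {P} {Q} (agree-off λ l l≢k →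
                   trans (sym (A⊑P l (x≢y⇒x∈∁⁅y⁆ l≢k))) (A⊑Q l (x≢y⇒x∈∁⁅y⁆ l≢k))) eq)

    neighbour-unique : ∀ {k A B D} → A ~⟨ k ⟩ B → A ~⟨ k ⟩ D →
                       ch A k ≢ ch B k → ch A k ≢ ch D k → ch B k ≡ ch D k
    neighbour-unique {k} {A} {B} {D} A~B A~D A≢B A≢D with panel k A
    ... | P , Q , P≢Q , two with two A (agree-off λ _ _ → refl) | two B A~B | two D A~D
    ... | inj₁ a | inj₁ b | _      = ⊥-elim (A≢B (trans a (sym b)))
    ... | inj₁ a | inj₂ b | inj₁ d = ⊥-elim (A≢D (trans a (sym d)))
    ... | inj₁ _ | inj₂ b | inj₂ d = trans b (sym d)
    ... | inj₂ a | inj₂ b | _      = ⊥-elim (A≢B (trans a (sym b)))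
    ... | inj₂ a | inj₁ b | inj₂ d = ⊥-elim (A≢D (trans a (sym d)))
    ... | inj₂ _ | inj₁ b | inj₁ d = trans b (sym d)

    adjacent-≟ : ∀ {k A B} → A ~⟨ k ⟩ B → Dec (ch A k ≡ ch B k)
    adjacent-≟ {k} {A} {B} A~B with panel k A
    ... | P , Q , P≢Q , two with two A (agree-off λ _ _ → refl) | two B A~B
    ... | inj₁ a | inj₁ b = yes (trans a (sym b))
    ... | inj₁ a | inj₂ b = no (λ e → P≢Q (trans (sym a) (trans e b)))
    ... | inj₂ a | inj₂ b = yes (trans a (sym b))
    ... | inj₂ a | inj₁ b = no (λ e → P≢Q (trans (sym b) (trans (sym e) a)))

  module Galleries (ig : IsIncidenceGeometry Γ) (rc : ResiduallyConnected Γ) where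
    private
      ConnectedAbove : ∀ {J} → Flag Γ J → Set
      ConnectedAbove {J} F = ∀ {y} (y∈Res : InRes Γ F y) {A B} →
        _⊑_ Γ (extend F y y∈Res) A → _⊑_ Γ (extend F y y∈Res) B → Gallery (J ∪ ⁅ t y ⁆) A B

      walk : ∀ {J} (F : Flag Γ J) → ConnectedAbove F →
             ∀ {y z} → Star (ResEdge Γ F) y z → ∀ P → _⊑_ Γ F P → P ∋ y →
             Σ (Chamber Γ) λ Q → _⊑_ Γ F Q × Q ∋ z × Gallery J P Q
      walk F connect ε P F⊑P P∋y = _ , F⊑P , P∋y , ε
      walk F connect {y} (_◅_ {j = y'} (y∈Res , y'∈Res , y*y') path) P F⊑P P∋y with t y' ≟ t y
      ... | yes ty'≡ty = walk F connect path P F⊑P (subst (P ∋_) (*-type y*y' (sym ty'≡ty)) P∋y)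
      ... | no ty'≢ty
        with chamber-extending ig (extend F y y∈Res) (InRes-extend F y y∈Res y'∈Res (*-sym y*y') ty'≢ty)
      ... | Q , ext⊑Q , Q∋y' with walk F connect path Q (extend-⊑⇒⊑ F y y∈Res Q ext⊑Q) Q∋y'
      ... | R , F⊑R , R∋z , Q→R =
        R , F⊑R , R∋z , Gallery-antimono (p⊆p∪q _) (connect y∈Res (⊑-extend F y y∈Res P F⊑P P∋y) ext⊑Q) ◅◅ Q→R

      residue-path⇒gallery : ∀ {J} (F : Flag Γ J) → ConnectedAbove F →
                             ∀ {y z} → Star (ResEdge Γ F) y z → (z∈Res : InRes Γ F z) →
                             ∀ A B → _⊑_ Γ F A → _⊑_ Γ F B → A ∋ y → B ∋ z → Gallery J A B
      residue-path⇒gallery F connect {z = z} path z∈Res A B F⊑A F⊑B A∋y B∋z with walk F connect path A F⊑A A∋y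
      ... | Q , F⊑Q , Q∋z , A→Q =
        A→Q ◅◅ Gallery-antimono (p⊆p∪q _)
                 (connect z∈Res (⊑-extend F z z∈Res Q F⊑Q Q∋z) (⊑-extend F z z∈Res B F⊑B B∋z))

    -- Induction on the corank of F, bounded by d: a path in the (connected) residue of F is
    -- followed through residues of flags extending F.
    gallery : ∀ d {J} (F : Flag Γ J) → n ≤ d + ∣ J ∣ → ∀ {A B} → _⊑_ Γ F A → _⊑_ Γ F B → Gallery J A B
    gallery d {J} F n≤d+J {A} {B} F⊑A F⊑B with nonempty? (∁ J)
    ... | no J-full = same (λ i → trans (sym (F⊑A i (in-J i))) (F⊑B i (in-J i))) ◅ ε
      where
      in-J : ∀ i → i ∈ J
      in-J i = x∉∁p⇒x∈p (λ i∈∁J → J-full (i , i∈∁J))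
    ... | yes (k , k∈∁J) with 2 + ∣ J ∣ ≤? n
    ...   | no corank-1 = adjacent k k∉J (agree-off A~B) ◅ ε
      where
      k∉J = x∈∁p⇒x∉p k∈∁J
      A~B : ∀ l → l ≢ k → ch A l ≡ ch B l
      A~B l l≢k with l ∈? J
      ... | yes l∈J = trans (sym (F⊑A l l∈J)) (F⊑B l l∈J)
      ... | no l∉J = ⊥-elim (corank-1 (x∉p∧y∉p∧x≢y⇒2+∣p∣≤n k∉J l∉J (l≢k ∘ sym)))
    gallery 0 F n≤J _ _ | yes _ | yes 2+J≤n = ⊥-elim (<⇒≱ 2+J≤n (m≤n⇒m≤1+n n≤J))
    gallery (suc d) {J} F n≤1+d+J {A} {B} F⊑A F⊑B | yes (k , k∈∁J) | yes 2+J≤n =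
      residue-path⇒gallery F connect (rc J F 2+J≤n (ch A k) (ch B k) Ak∈Res Bk∈Res) Bk∈Res
                           A B F⊑A F⊑B (ch-∋ A k) (ch-∋ B k)
      where
      Ak∈Res = ch-InRes F A F⊑A (x∈∁p⇒x∉p k∈∁J)
      Bk∈Res = ch-InRes F B F⊑B (x∈∁p⇒x∉p k∈∁J)
      connect : ConnectedAbove F
      connect y∈Res = gallery d (extend F _ y∈Res) (n≤1+d+∣p∣⇒n≤d+∣p∪⁅x⁆∣ n≤1+d+J (proj₁ y∈Res))

    residue-gallery : ∀ {J} (F : Flag Γ J) {A B} → _⊑_ Γ F A → _⊑_ Γ F B → Gallery J A B
    residue-gallery F = gallery n F (m≤m+n n _)

    connected : ∀ A B → Gallery ⊥ A B
    connected A B = residue-gallery (A ↾ ⊥) (λ _ _ → refl) (λ _ p → ⊥-elim (∉⊥ p))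

  module Transitivity (ig : IsIncidenceGeometry Γ) (ft : FlagTransitive Γ) where
    chamber-transitive : ∀ A B → Σ (Aut Γ) λ φ → ∀ i → f φ (ch A i) ≡ ch B i
    chamber-transitive A B with ft ⊤ (A ↾ ⊤) (B ↾ ⊤)
    ... | φ , φA≡B = φ , λ i → φA≡B i ∈⊤

    transitive-on-elements : ∀ A {i} y → t y ≡ i → Σ (Aut Γ) λ φ → f φ (ch A i) ≡ y
    transitive-on-elements A y refl with chamber-through ig y
    ... | B , B∋y with chamber-transitive A B
    ... | φ , φA≡B = φ , trans (φA≡B (t y)) B∋y

    transitive-on-pairs : ∀ A {i j} y z → t y ≡ i → t z ≡ j → i ≢ j → y * z →
                          Σ (Aut Γ) λ φ → f φ (ch A i) ≡ y × f φ (ch A j) ≡ z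
    transitive-on-pairs A y z refl refl ty≢tz y*z with chamber-through₂ ig y*z ty≢tz
    ... | B , B∋y , B∋z with chamber-transitive A B
    ... | φ , φA≡B = φ , trans (φA≡B (t y)) B∋y , trans (φA≡B (t z)) B∋z

  module Rigidity (ig : IsIncidenceGeometry Γ) (thin : Thin Γ) (rc : ResiduallyConnected Γ) where
    open Panels thin
    open Galleries ig rc

    private
      Agree : Aut Γ → Aut Γ → Chamber Γ → Set
      Agree φ ψ A = _≈ᶜ_ Γ (φ · A) (ψ · A)

      agree-step : ∀ φ ψ {J A B} → Step J A B → Agree φ ψ A → Agree φ ψ B
      agree-step φ ψ (same A≈B) agree i = subst (λ x → f φ x ≡ f ψ x) (A≈B i) (agree i)
      agree-step φ ψ {J} {A} {B} (adjacent k _ A~B) agree with adjacent-≟ A~B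
      ... | yes Ak≡Bk = agree-step φ ψ {J} {A} {B} (same (~⟨⟩⇒≈ᶜ A~B Ak≡Bk)) agree
      ... | no Ak≢Bk =
        ~⟨⟩⇒≈ᶜ φB~ψB (neighbour-unique φA~φB φA~ψB (Ak≢Bk ∘ injective φ) (Ak≢Bk ∘ injective ψ ∘ trans (sym (agree k))))
        where
        φA~φB : φ · A ~⟨ k ⟩ φ · B
        φA~φB = agree-off λ l l≢k → cong (f φ) (at A~B l l≢k)
        φA~ψB : φ · A ~⟨ k ⟩ ψ · B
        φA~ψB = agree-off λ l l≢k → trans (agree l) (cong (f ψ) (at A~B l l≢k))
        φB~ψB : φ · B ~⟨ k ⟩ ψ · B
        φB~ψB = agree-off λ l l≢k → trans (sym (cong (f φ) (at A~B l l≢k))) (at φA~ψB l l≢k)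

      agree-gallery : ∀ φ ψ {J A B} → Gallery J A B → Agree φ ψ A → Agree φ ψ B
      agree-gallery φ ψ ε = id
      agree-gallery φ ψ (s ◅ g) = agree-gallery φ ψ g ∘ agree-step φ ψ s

    agree-on-chamber⇒≈ᴬ : ∀ φ ψ A → _≈ᶜ_ Γ (φ · A) (ψ · A) → _≈ᴬ_ Γ φ ψ
    agree-on-chamber⇒≈ᴬ φ ψ A agree x with chamber-through ig x
    ... | B , B∋x = subst (λ y → f φ y ≡ f ψ y) B∋x (agree-gallery φ ψ (connected A B) agree (t x))

    module Generators (C : Chamber Γ) (ρ : Fin n → Aut Γ) (SG : StandardGenerators Γ C ρ) where
      ρ-fixes : ∀ {i j} → j ≢ i → f (ρ i) (ch C j) ≡ ch C j
      ρ-fixes {i} {j} = proj₁ (SG i) j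

      ρ-moves : ∀ i → f (ρ i) (ch C i) ≢ ch C i
      ρ-moves i = proj₂ (SG i)

      ρ-type : ∀ i → t (f (ρ i) (ch C i)) ≡ i
      ρ-type i = ch-type (ρ i · C) i

      ρ-involutive : ∀ i x → f (ρ i) (f (ρ i) x) ≡ x
      ρ-involutive i = agree-on-chamber⇒≈ᴬ (_∘ᴬ_ Γ (ρ i) (ρ i)) (idA Γ) C back
        where
        back : ∀ l → f (ρ i) (f (ρ i) (ch C l)) ≡ ch C l
        back l with l ≟ i
        ... | no l≢i = trans (cong (f (ρ i)) (ρ-fixes l≢i)) (ρ-fixes l≢i)
        ... | yes refl = sym (neighbour-unique {A = ρ i · C} {C} {ρ i · ρ i · C}
                                (agree-off λ l l≢i → ρ-fixes l≢i)
                                (agree-off λ l l≢i → cong (f (ρ i)) (sym (ρ-fixes l≢i)))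
                                (ρ-moves i) (ρ-moves i ∘ sym ∘ injective (ρ i)))

      ρ⁻¹≡ρ : ∀ i x → g (ρ i) x ≡ f (ρ i) x
      ρ⁻¹≡ρ i x = f≡⇒g≡ (ρ i) (ρ-involutive i x)

      -- Replacing the a-element of ρ_b C by Dₐ = ρₐ Cₐ gives a chamber Q. Both Q and ρ_b ρₐ C are
      -- a-adjacent to ρ_b C, so by thinness ρ_b Dₐ = Dₐ.
      ρ-fixes-neighbour : ∀ {a b} → a ≢ b → f (ρ a) (ch C a) * f (ρ b) (ch C b) →
                          f (ρ b) (f (ρ a) (ch C a)) ≡ f (ρ a) (ch C a)
      ρ-fixes-neighbour {a} {b} a≢b Dₐ*D_b with chamber-extending ig (ρ b · C ↾ ∁ ⁅ a ⁆) Dₐ∈Res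
        where
        Dₐ = f (ρ a) (ch C a)
        Dₐ∈Res : InRes Γ (ρ b · C ↾ ∁ ⁅ a ⁆) Dₐ
        Dₐ∈Res = (λ p → x∈∁⁅y⁆⇒x≢y p (ρ-type a)) , inc
          where
          inc : ∀ l → l ∈ ∁ ⁅ a ⁆ → Dₐ * f (ρ b) (ch C l)
          inc l p with l ≟ b
          ... | yes refl = Dₐ*D_b
          ... | no l≢b =
            subst (Dₐ *_) (trans (ρ-fixes (x∈∁⁅y⁆⇒x≢y p)) (sym (ρ-fixes l≢b))) (f-inc (ρ a) (ch-inc C a l))
      ... | Q , ρbC⊑Q , Q∋Dₐ = trans (neighbour-unique {A = ρ b · C} E~ρbρaC E~Q ne₁ ne₂) Qa≡Dₐ
        where
        Qa≡Dₐ : ch Q a ≡ f (ρ a) (ch C a)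
        Qa≡Dₐ = subst (λ l → ch Q l ≡ f (ρ a) (ch C a)) (ρ-type a) Q∋Dₐ
        E~ρbρaC : ρ b · C ~⟨ a ⟩ ρ b · ρ a · C
        E~ρbρaC = agree-off λ l l≢a → cong (f (ρ b)) (sym (ρ-fixes l≢a))
        E~Q : ρ b · C ~⟨ a ⟩ Q
        E~Q = agree-off λ l l≢a → ρbC⊑Q l (x≢y⇒x∈∁⁅y⁆ l≢a)
        ne₁ : f (ρ b) (ch C a) ≢ f (ρ b) (f (ρ a) (ch C a))
        ne₁ = ρ-moves a ∘ sym ∘ injective (ρ b)
        ne₂ : f (ρ b) (ch C a) ≢ ch Q a
        ne₂ e = ρ-moves a (sym (trans (sym (ρ-fixes a≢b)) (trans e Qa≡Dₐ)))

      ρ-commute : ∀ {a b} → a ≢ b → f (ρ a) (ch C a) * f (ρ b) (ch C b) →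
                  ∀ x → f (ρ a) (f (ρ b) x) ≡ f (ρ b) (f (ρ a) x)
      ρ-commute {a} {b} a≢b Dₐ*D_b = agree-on-chamber⇒≈ᴬ (_∘ᴬ_ Γ (ρ a) (ρ b)) (_∘ᴬ_ Γ (ρ b) (ρ a)) C on-C
        where
        on-C : ∀ l → f (ρ a) (f (ρ b) (ch C l)) ≡ f (ρ b) (f (ρ a) (ch C l))
        on-C l with l ≟ a | l ≟ b
        ... | yes refl | _ = trans (cong (f (ρ a)) (ρ-fixes a≢b)) (sym (ρ-fixes-neighbour a≢b Dₐ*D_b))
        ... | no l≢a | yes refl =
          trans (ρ-fixes-neighbour l≢a (*-sym Dₐ*D_b)) (cong (f (ρ b)) (sym (ρ-fixes l≢a)))
        ... | no l≢a | no l≢b =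
          trans (cong (f (ρ a)) (ρ-fixes l≢b))
                (trans (ρ-fixes l≢a) (sym (trans (cong (f (ρ b)) (ρ-fixes l≢a)) (ρ-fixes l≢b))))

      NoEdge⇒ρ-commute : ∀ {a b} → NoEdge Γ a b → a ≢ b → ∀ x → f (ρ a) (f (ρ b) x) ≡ f (ρ b) (f (ρ a) x)
      NoEdge⇒ρ-commute {a} {b} no-edge a≢b =
        ρ-commute a≢b (no-edge (C ↾ ∁ S) _ _ (ρ-InRes (x∈p∪q⁺ (inj₁ (x∈⁅x⁆ a))))
                                             (ρ-InRes (x∈p∪q⁺ (inj₂ (x∈⁅x⁆ b))))
                                             (ρ-type a) (ρ-type b))
        where
        S = ⁅ a ⁆ ∪ ⁅ b ⁆
        ρ-InRes : ∀ {i} → i ∈ S → InRes Γ (C ↾ ∁ S) (f (ρ i) (ch C i))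
        ρ-InRes {i} i∈S =
          (λ p → x∈p⇒x∉∁p i∈S (subst (_∈ ∁ S) (ρ-type i) p)) ,
          (λ l p → subst (f (ρ i) (ch C i) *_) (ρ-fixes (λ { refl → x∈∁p⇒x∉p p i∈S }))
                         (f-inc (ρ i) (ch-inc C i l)))

      private
        Reached : Subset n → Chamber Γ → Set
        Reached K A = Σ (Word Γ K) λ w → _≈ᶜ_ Γ (eval Γ ρ w · C) A

        -- If w C = A and B is k-adjacent to A, then (w ρₖ) C = B by thinness.
        reached-step : ∀ {J A B} → Step J A B → Reached (∁ J) A → Reached (∁ J) B
        reached-step (same A≈B) (w , w·C≈A) = w , λ l → trans (w·C≈A l) (A≈B l)
        reached-step {A = A} {B} (adjacent k k∉J A~B) (w , w·C≈A) with adjacent-≟ A~B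
        ... | yes Ak≡Bk = w , λ l → trans (w·C≈A l) (~⟨⟩⇒≈ᶜ A~B Ak≡Bk l)
        ... | no Ak≢Bk =
          w ++ ((k , x∉p⇒x∈∁p k∉J) , true) ∷ [] , λ l → trans (eval-++ ρ w _ (ch C l)) (~⟨⟩⇒≈ᶜ B'~B B'k≡Bk l)
          where
          φ = eval Γ ρ w
          A~B' : A ~⟨ k ⟩ φ · ρ k · C
          A~B' = agree-off λ l l≢k → trans (sym (w·C≈A l)) (cong (f φ) (sym (ρ-fixes l≢k)))
          B'~B : φ · ρ k · C ~⟨ k ⟩ B
          B'~B = agree-off λ l l≢k → trans (sym (at A~B' l l≢k)) (at A~B l l≢k)
          B'k≡Bk : f φ (f (ρ k) (ch C k)) ≡ ch B k
          B'k≡Bk = neighbour-unique A~B' A~B (λ e → ρ-moves k (sym (injective φ (trans (w·C≈A k) e)))) Ak≢Bk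

        reached : ∀ {J A B} → Gallery J A B → Reached (∁ J) A → Reached (∁ J) B
        reached ε = id
        reached (s ◅ g) = reached g ∘ reached-step s

      stabilizer-generated : ∀ J ψ → (∀ j → j ∈ J → f ψ (ch C j) ≡ ch C j) → InGen Γ ρ (∁ J) ψ
      stabilizer-generated J ψ ψ-fixes
        with reached {J} {C} {ψ · C} (residue-gallery (C ↾ J) (λ _ _ → refl) (λ j p → sym (ψ-fixes j p)))
                     ([] , λ _ → refl)
      ... | w , w·C≈ψ·C = w , agree-on-chamber⇒≈ᴬ (eval Γ ρ w) ψ C w·C≈ψ·C

      element-stabilizer-generated : ∀ i ψ → f ψ (ch C i) ≡ ch C i → InGen Γ ρ (∁ ⁅ i ⁆) ψ
      element-stabilizer-generated i ψ ψ-fixes =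
        stabilizer-generated ⁅ i ⁆ ψ (λ j p → subst (λ j → f ψ (ch C j) ≡ ch C j) (sym (x∈⁅y⁆⇒x≡y i p)) ψ-fixes)

module Halving {m : ℕ} (Γ : Geometry (suc (suc m)))
               (ig : IsIncidenceGeometry Γ) (thin : Thin Γ) (rc : ResiduallyConnected Γ) (ft : FlagTransitive Γ)
               (C : Chamber Γ) (ρ : Fin (suc (suc m)) → Aut Γ) (SG : StandardGenerators Γ C ρ)
               (0≁j : ∀ j → j ≢ 0F → j ≢ 1F → NoEdge Γ 0F j) where
  open Geometry Γ
  open Incidence Γ
  open Transitivity ig ft
  open Rigidity ig thin rc
  open Generators C ρ SG

  C₀ C₁ D₀ : X
  C₀ = ch C 0F
  C₁ = ch C 1F
  D₀ = f (ρ 0F) C₀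

  C₀≢D₀ : C₀ ≢ D₀
  C₀≢D₀ = ρ-moves 0F ∘ sym

  D₀*C₁ : D₀ * C₁
  D₀*C₁ = subst (D₀ *_) (ρ-fixes (λ ())) (f-inc (ρ 0F) (ch-inc C 0F 1F))

  ρ₀-commute : ∀ j → j ≢ 0F → j ≢ 1F → ∀ x → f (ρ 0F) (f (ρ j) x) ≡ f (ρ j) (f (ρ 0F) x)
  ρ₀-commute j j≢0 j≢1 = NoEdge⇒ρ-commute (0≁j j j≢0 j≢1) (j≢0 ∘ sym)

  C₀-or-D₀ : X → Set
  C₀-or-D₀ x = x ≡ C₀ ⊎ x ≡ D₀

  ρ-permutes-C₀-D₀ : ∀ i → i ≢ 1F → ∀ {x} → C₀-or-D₀ x → C₀-or-D₀ (f (ρ i) x)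
  ρ-permutes-C₀-D₀ 0F _ (inj₁ refl) = inj₂ refl
  ρ-permutes-C₀-D₀ 0F _ (inj₂ refl) = inj₁ (ρ-involutive 0F C₀)
  ρ-permutes-C₀-D₀ 1F i≢1 _ = ⊥-elim (i≢1 refl)
  ρ-permutes-C₀-D₀ (suc (suc _)) _ (inj₁ refl) = inj₁ (ρ-fixes (λ ()))
  ρ-permutes-C₀-D₀ j@(suc (suc _)) _ (inj₂ refl) =
    inj₂ (trans (sym (ρ₀-commute j (λ ()) (λ ()) C₀)) (cong (f (ρ 0F)) (ρ-fixes (λ ()))))

  shadow-C₁ : ∀ {x} → t x ≡ 0F → x * C₁ → C₀-or-D₀ x
  shadow-C₁ {x} tx≡0 x*C₁ with transitive-on-pairs C x C₁ tx≡0 (ch-type C 1F) (λ ()) x*C₁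
  ... | φ , φC₀≡x , φC₁≡C₁ with element-stabilizer-generated 1F φ φC₁≡C₁
  ... | w , w≈φ = subst C₀-or-D₀ (trans (w≈φ C₀) φC₀≡x) (eval-preserves ρ C₀-or-D₀ invariant w (inj₁ refl))
    where
    invariant : ∀ i → i ∈ ∁ ⁅ 1F ⁆ → ∀ {x} → C₀-or-D₀ x → C₀-or-D₀ (f (ρ i) x) × C₀-or-D₀ (g (ρ i) x)
    invariant i i∈ x∈ = ρx∈ , subst C₀-or-D₀ (sym (ρ⁻¹≡ρ i _)) ρx∈
      where ρx∈ = ρ-permutes-C₀-D₀ i (x∈∁⁅y⁆⇒x≢y i∈) x∈

  ψ-fixes-D₀ : ∀ ψ {e} → f ψ C₀ ≡ C₀ → f ψ C₁ ≡ e → D₀ * e → f ψ D₀ ≡ D₀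
  ψ-fixes-D₀ ψ ψC₀≡C₀ ψC₁≡e D₀*e with shadow-C₁ (trans (f-type (invA Γ ψ) D₀) (ρ-type 0F)) (*-pull ψ ψC₁≡e D₀*e)
  ... | inj₁ ψ⁻¹D₀≡C₀ = ⊥-elim (C₀≢D₀ (trans (sym ψC₀≡C₀) (g≡⇒f≡ ψ ψ⁻¹D₀≡C₀)))
  ... | inj₂ ψ⁻¹D₀≡D₀ = g≡⇒f≡ ψ ψ⁻¹D₀≡D₀

  stabilizer-C₀ : ∀ ψ → f ψ C₀ ≡ C₀ → InGen Γ (halving Γ ρ) (∁ ⁅ 0F ⁆) ψ
  stabilizer-C₀ ψ ψC₀≡C₀ = InGen-relabel ρ (halving Γ ρ) id id ρ≈h ψ (element-stabilizer-generated 0F ψ ψC₀≡C₀)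
    where
    ρ≈h : ∀ i → i ∈ ∁ ⁅ 0F ⁆ → _≈ᴬ_ Γ (ρ i) (halving Γ ρ i)
    ρ≈h 0F 0∈ = ⊥-elim (x∈∁⁅y⁆⇒x≢y 0∈ refl)
    ρ≈h (suc i) _ _ = refl

  -- D₀ is the 0-element of ρ₀ C, whose standard generators ρ₀ ρⱼ ρ₀⁻¹ are h₀ for j = 1
  -- and hⱼ for j ≥ 2.
  stabilizer-D₀ : ∀ ψ → f ψ D₀ ≡ D₀ → InGen Γ (halving Γ ρ) (∁ ⁅ 1F ⁆) ψ
  stabilizer-D₀ ψ ψD₀≡D₀ =
    InGen-relabel (conjugate (ρ 0F) ρ) (halving Γ ρ) (transpose 0F 1F) σ∈ ρ₀ρρ₀≈h ψ
      (Generators.element-stabilizer-generated (ρ 0F · C) (conjugate (ρ 0F) ρ)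
        (StandardGenerators-conjugate {C} {ρ} (ρ 0F) SG) 0F ψ ψD₀≡D₀)
    where
    σ∈ : ∀ {i} → i ∈ ∁ ⁅ 0F ⁆ → transpose 0F 1F i ∈ ∁ ⁅ 1F ⁆
    σ∈ {0F} 0∈ = ⊥-elim (x∈∁⁅y⁆⇒x≢y 0∈ refl)
    σ∈ {1F} _ = x≢y⇒x∈∁⁅y⁆ {y = 1F} λ ()
    σ∈ {suc (suc _)} _ = x≢y⇒x∈∁⁅y⁆ {y = 1F} λ ()
    ρ₀ρρ₀≈h : ∀ i → i ∈ ∁ ⁅ 0F ⁆ → _≈ᴬ_ Γ (conjugate (ρ 0F) ρ i) (halving Γ ρ (transpose 0F 1F i))
    ρ₀ρρ₀≈h 0F 0∈ = ⊥-elim (x∈∁⁅y⁆⇒x≢y 0∈ refl)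
    ρ₀ρρ₀≈h 1F _ x = cong (f (ρ 0F) ∘ f (ρ 1F)) (ρ⁻¹≡ρ 0F x)
    ρ₀ρρ₀≈h j@(suc (suc _)) _ x = trans (ρ₀-commute j (λ ()) (λ ()) (g (ρ 0F) x)) (cong (f (ρ j)) (fg (ρ 0F) x))

  two-ends : ∀ e → t e ≡ 1F →
             Σ X λ a → Σ X λ b → t a ≡ 0F × t b ≡ 0F × a ≢ b × a * e × b * e ×
               (∀ c → t c ≡ 0F → c * e → c ≡ a ⊎ c ≡ b)
  two-ends e te≡1 with transitive-on-elements C e te≡1
  ... | φ , φC₁≡e =
    f φ C₀ , f φ D₀ , trans (f-type φ C₀) (ch-type C 0F) , trans (f-type φ D₀) (ρ-type 0F) ,
    C₀≢D₀ ∘ injective φ ,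
    subst (f φ C₀ *_) φC₁≡e (f-inc φ (ch-inc C 0F 1F)) , subst (f φ D₀ *_) φC₁≡e (f-inc φ D₀*C₁) ,
    λ c tc≡0 c*e → Sum.map (sym ∘ g≡⇒f≡ φ) (sym ∘ g≡⇒f≡ φ)
                     (shadow-C₁ (trans (f-type (invA Γ φ) c) tc≡0) (*-pull φ φC₁≡e c*e))

  module _ (IP : IntersectionProperty Γ (halving Γ ρ)) where
    C₁-unique : ∀ {e} → t e ≡ 1F → C₀ * e → D₀ * e → e ≡ C₁
    C₁-unique {e} te≡1 C₀*e D₀*e with transitive-on-pairs C C₀ e (ch-type C 0F) te≡1 (λ ()) C₀*e
    ... | ψ , ψC₀≡C₀ , ψC₁≡e
      with proj₁ (IP (∁ ⁅ 1F ⁆) (∁ ⁅ 0F ⁆) ψ)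
                 (stabilizer-D₀ ψ (ψ-fixes-D₀ ψ ψC₀≡C₀ ψC₁≡e D₀*e) , stabilizer-C₀ ψ ψC₀≡C₀)
    ... | w , w≈ψ = trans (sym ψC₁≡e) (trans (sym (w≈ψ C₁)) (eval-fixes (halving Γ ρ) C₁ fixes-C₁ w))
      where
      fixes-C₁ : ∀ i → i ∈ ∁ ⁅ 1F ⁆ ∩ ∁ ⁅ 0F ⁆ → f (halving Γ ρ i) C₁ ≡ C₁
      fixes-C₁ 0F i∈ = ⊥-elim (x∈∁⁅y⁆⇒x≢y (proj₂ (x∈p∩q⁻ (∁ ⁅ 1F ⁆) (∁ ⁅ 0F ⁆) i∈)) refl)
      fixes-C₁ 1F i∈ = ⊥-elim (x∈∁⁅y⁆⇒x≢y (proj₁ (x∈p∩q⁻ (∁ ⁅ 1F ⁆) (∁ ⁅ 0F ⁆) i∈)) refl)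
      fixes-C₁ (suc (suc _)) _ = ρ-fixes (λ ())

    common-unique : ∀ a b e e' → t a ≡ 0F → t b ≡ 0F → a ≢ b → t e ≡ 1F → t e' ≡ 1F →
                    a * e → b * e → a * e' → b * e' → e ≡ e'
    common-unique a b e e' ta≡0 tb≡0 a≢b te≡1 te'≡1 a*e b*e a*e' b*e'
      with transitive-on-pairs C a e ta≡0 te≡1 (λ ()) a*e
    ... | φ , φC₀≡a , φC₁≡e
      with shadow-C₁ (trans (f-type (invA Γ φ) b) tb≡0) (*-pull φ φC₁≡e b*e)
    ... | inj₁ φ⁻¹b≡C₀ = ⊥-elim (a≢b (trans (sym φC₀≡a) (g≡⇒f≡ φ φ⁻¹b≡C₀)))
    ... | inj₂ φ⁻¹b≡D₀ =
      trans (sym φC₁≡e) (g≡⇒f≡ φ (C₁-unique (trans (f-type (invA Γ φ) e') te'≡1)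
                                     (*-sym (*-pull φ φC₀≡a (*-sym a*e')))
                                     (subst (_* g φ e') φ⁻¹b≡D₀ (f-inc (invA Γ φ) b*e'))))

    B1-holds : B1 Γ 0F 1F
    B1-holds = two-ends , common-unique

proposition4p7 : (m : ℕ) (Γ : Geometry (suc (suc m))) →
    RegularHypertope Γ →
    Edge Γ zero (suc zero) →
    (∀ (j : Fin (suc (suc m))) → j ≢ zero → j ≢ suc zero → NoEdge Γ zero j) →
    ¬ B1 Γ zero (suc zero) →
    (C : Chamber Γ) (ρ : Fin (suc (suc m)) → Aut Γ) →
    StandardGenerators Γ C ρ →
    ¬ IsCGroup Γ (halving Γ ρ)
proposition4p7 m Γ (ig , thin , rc , ft) _ 0≁j ¬B1 C ρ SG (_ , IP) =
  ¬B1 (Halving.B1-holds Γ ig thin rc ft C ρ SG 0≁j IP)
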